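{- Let $\mathcal{G}$ be an extended parsing expression grammar (XPEG), as described in the context. For every parsing expression $e$ over $\mathcal{G}$, every string $s$, every natural number $m$ and every semantic value $v$: if $(e,s)\Rightarrow_m \mathrm{ok}(v,s)$ (i.e. $e$ succeeds on $s$ without consuming input), then there is no $n$ and no result $r$ with $(e^*,s)\Rightarrow_n r$.
   Context: Fix a finite set $V_T$ of terminals and a finite set $V_N$ of non-terminals. Strings are finite lists of terminals; $[]$ is the empty list and $x::xs$ the list with head $x$ and tail $xs$. An XPEG is a tuple $(V_T, V_N, P_{type}, P_{exp}, v_{start})$ where $P_{type}: V_N \to \mathrm{Type}$, $P_{exp}$ assigns to each $A \in V_N$ a parsing expression of type $\mathrm{PExp}(P_{type}(A))$, and $v_{start}\in V_N$. Parsing expressions are typed by their semantic-value type: $\epsilon : \mathrm{PExp}(\mathrm{True})$ (where $\mathrm{True}$ has the single value $I$); any-character $[\cdot] : \mathrm{PExp}(\mathrm{char})$; a terminal $'a' : \mathrm{PExp}(\mathrm{char})$ for $a\in V_T$; a non-terminal $A : \mathrm{PExp}(P_{type}(A))$; if $e_1:\mathrm{PExp}(\alpha)$, $e_2:\mathrm{PExp}(\beta)$ then the sequence $e_1;e_2 : \mathrm{PExp}(\alpha\times\beta)$; if $e_1,e_2:\mathrm{PExp}(\alpha)$ then the prioritized choice $e_1/e_2:\mathrm{PExp}(\alpha)$; if $e:\mathrm{PExp}(\alpha)$ then the repetition $e^* : \mathrm{PExp}(\mathrm{list}\,\alpha)$ and the not-predicate $!e : \mathrm{PExp}(\mathrm{True})$;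 if $e:\mathrm{PExp}(\alpha)$ and $f:\alpha\to\beta$ then the coercion $e[\to f]:\mathrm{PExp}(\beta)$. The semantics is the inductively defined relation $(e,s)\Rightarrow_m r$ (expression $e$ on string $s$ yields in $m$ steps result $r$, where $r$ is either $\bot$ (failure) or $\mathrm{ok}(v,s')$ with $v$ a semantic value and $s'$ the remaining input), given by the rules: $(\epsilon,s)\Rightarrow_1\mathrm{ok}(I,s)$; if $(P_{exp}(A),s)\Rightarrow_m r$ then $(A,s)\Rightarrow_{m+1} r$; $([\cdot],x::xs)\Rightarrow_1\mathrm{ok}(x,xs)$; $([\cdot],[])\Rightarrow_1\bot$; $('x',x::xs)\Rightarrow_1\mathrm{ok}(x,xs)$; $('x',[])\Rightarrow_1\bot$; if $x\neq y$ then $('y',x::xs)\Rightarrow_1\bot$; if $(e_1,s)\Rightarrow_m\bot$ and $(e_2,s)\Rightarrow_n r$ then $(e_1/e_2,s)\Rightarrow_{m+n+1} r$; if $(e_1,s)\Rightarrow_m\mathrm{ok}(v,s')$ then $(e_1/e_2,s)\Rightarrow_{m+1}\mathrm{ok}(v,s')$; if $(e_1,s)\Rightarrow_m\bot$ then $(e_1;e_2,s)\Rightarrow_{m+1}\bot$; if $(e_1,s)\Rightarrow_m\mathrm{ok}(v_1,s')$ and $(e_2,s')\Rightarrow_n\bot$ then $(e_1;e_2,s)\Rightarrow_{m+n+1}\bot$; if $(e_1,s)\Rightarrow_m\mathrm{ok}(v_1,s')$ and $(e_2,s')\Rightarrow_n\mathrm{ok}(v_2,s'')$ then $(e_1;e_2,s)\Rightarrow_{m+n+1}\mathrm{ok}((v_1,v_2),s'')$;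 if $(e,s)\Rightarrow_m\bot$ then $(e^*,s)\Rightarrow_{m+1}\mathrm{ok}([],s)$; if $(e,s)\Rightarrow_m\mathrm{ok}(v,s')$ and $(e^*,s')\Rightarrow_n\mathrm{ok}(vs,s'')$ then $(e^*,s)\Rightarrow_{m+n+1}\mathrm{ok}(v::vs,s'')$; if $(e,s)\Rightarrow_m\bot$ then $(!e,s)\Rightarrow_{m+1}\mathrm{ok}(I,s)$; if $(e,s)\Rightarrow_m\mathrm{ok}(v,s')$ then $(!e,s)\Rightarrow_{m+1}\bot$; if $(e,s)\Rightarrow_m\mathrm{ok}(v,s')$ then $(e[\to f],s)\Rightarrow_{m+1}\mathrm{ok}(f(v),s')$; if $(e,s)\Rightarrow_m\bot$ then $(e[\to f],s)\Rightarrow_{m+1}\bot$. -}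

module Defs where

open import Data.Nat using (ℕ; suc; _+_)
open import Data.List using (List; []; _∷_)
open import Data.Product using (_×_; _,_)
open import Data.Unit using (⊤; tt)
open import Data.Fin using (Fin)
open import Function.Bundles using (_↔_)
open import Relation.Binary.PropositionalEquality using (_≡_)
open import Relation.Nullary using (¬_)

True : Set
True = ⊤

I : True
I = tt

data PExp (VT : Set) (VN : Set) (Ptype : VN → Set) : Set → Set₁ where
  ε     : PExp VT VN Ptype True
  any   : PExp VT VN Ptype VT
  term  : VT → PExp VT VN Ptype VT
  nt    : (A : VN) → PExp VT VN Ptype (Ptype A)
  _︔_   : ∀ {α β} → PExp VT VN Ptype α → PExp VT VN Ptype β → PExp VT VN Ptype (α × β)
  _/_   : ∀ {α} → PExp VT VN Ptype α → PExp VT VN Ptype α → PExp VT VN Ptype α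
  _*    : ∀ {α} → PExp VT VN Ptype α → PExp VT VN Ptype (List α)
  !_    : ∀ {α} → PExp VT VN Ptype α → PExp VT VN Ptype True
  _[→_] : ∀ {α β} → PExp VT VN Ptype α → (α → β) → PExp VT VN Ptype β

record XPEG : Set₂ where
  field
    VT      : Set
    VN      : Set
    nVT     : ℕ
    VT-fin  : VT ↔ Fin nVT
    nVN     : ℕ
    VN-fin  : VN ↔ Fin nVN
    Ptype   : VN → Set
    Pexp    : (A : VN) → PExp VT VN Ptype (Ptype A)
    vstart  : VN

data Result (VT : Set) (α : Set) : Set where
  fail : Result VT α
  ok   : α → List VT → Result VT α

module Semantics (G : XPEG) where
  open XPEG G

  Exp : Set → Set₁
  Exp = PExp VT VN Ptype

  data _,_⇒[_]_ : ∀ {α} → Exp α → List VT → ℕ → Result VT α → Set₁ where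
    ⇒ε      : ∀ {s} → ε , s ⇒[ 1 ] ok I s
    ⇒nt     : ∀ {A s m r} → Pexp A , s ⇒[ m ] r → nt A , s ⇒[ suc m ] r
    ⇒any    : ∀ {x xs} → any , (x ∷ xs) ⇒[ 1 ] ok x xs
    ⇒any-[] : any , [] ⇒[ 1 ] fail
    ⇒term   : ∀ {x xs} → term x , (x ∷ xs) ⇒[ 1 ] ok x xs
    ⇒term-[] : ∀ {x} → term x , [] ⇒[ 1 ] fail
    ⇒term-≠ : ∀ {x y xs} → ¬ (x ≡ y) → term y , (x ∷ xs) ⇒[ 1 ] fail
    ⇒/-fail : ∀ {α} {e₁ e₂ : Exp α} {s m n r} →
              e₁ , s ⇒[ m ] fail → e₂ , s ⇒[ n ] r → (e₁ / e₂) , s ⇒[ m + n + 1 ] r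
    ⇒/-ok   : ∀ {α} {e₁ e₂ : Exp α} {s m v s'} →
              e₁ , s ⇒[ m ] ok v s' → (e₁ / e₂) , s ⇒[ m + 1 ] ok v s'
    ⇒︔-fail₁ : ∀ {α β} {e₁ : Exp α} {e₂ : Exp β} {s m} →
              e₁ , s ⇒[ m ] fail → (e₁ ︔ e₂) , s ⇒[ m + 1 ] fail
    ⇒︔-fail₂ : ∀ {α β} {e₁ : Exp α} {e₂ : Exp β} {s s' m n v₁} →
              e₁ , s ⇒[ m ] ok v₁ s' → e₂ , s' ⇒[ n ] fail → (e₁ ︔ e₂) , s ⇒[ m + n + 1 ] fail
    ⇒︔-ok   : ∀ {α β} {e₁ : Exp α} {e₂ : Exp β} {s s' s'' m n v₁ v₂} →
              e₁ , s ⇒[ m ] ok v₁ s' → e₂ , s' ⇒[ n ] ok v₂ s'' →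
              (e₁ ︔ e₂) , s ⇒[ m + n + 1 ] ok (v₁ , v₂) s''
    ⇒*-fail : ∀ {α} {e : Exp α} {s m} →
              e , s ⇒[ m ] fail → (e *) , s ⇒[ m + 1 ] ok [] s
    ⇒*-ok   : ∀ {α} {e : Exp α} {s s' s'' m n v vs} →
              e , s ⇒[ m ] ok v s' → (e *) , s' ⇒[ n ] ok vs s'' →
              (e *) , s ⇒[ m + n + 1 ] ok (v ∷ vs) s''
    ⇒!-fail : ∀ {α} {e : Exp α} {s m} →
              e , s ⇒[ m ] fail → (! e) , s ⇒[ m + 1 ] ok I s
    ⇒!-ok   : ∀ {α} {e : Exp α} {s s' m v} →
              e , s ⇒[ m ] ok v s' → (! e) , s ⇒[ m + 1 ] fail
    ⇒→-ok   : ∀ {α β} {e : Exp α} {f : α → β} {s s' m v} →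
              e , s ⇒[ m ] ok v s' → (e [→ f ]) , s ⇒[ m + 1 ] ok (f v) s'
    ⇒→-fail : ∀ {α β} {e : Exp α} {f : α → β} {s m} →
              e , s ⇒[ m ] fail → (e [→ f ]) , s ⇒[ m + 1 ] fail

module Submission where

open import Defs
open import Data.Nat using (ℕ)
open import Data.List using (List)
open import Data.Product using (∃-syntax; _,_)
open import Data.Empty using (⊥-elim)
open import Relation.Nullary using (¬_)
open import Relation.Binary.PropositionalEquality using (_≡_; refl)

module _ (G : XPEG) where
  open XPEG G
  open Semantics G

  ⇒-deterministic : ∀ {α} {e : Exp α} {s m n r₁ r₂} →
                    e , s ⇒[ m ] r₁ → e , s ⇒[ n ] r₂ → r₁ ≡ r₂
  ⇒-deterministic ⇒ε ⇒ε = refl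
  ⇒-deterministic (⇒nt d) (⇒nt d') = ⇒-deterministic d d'
  ⇒-deterministic ⇒any ⇒any = refl
  ⇒-deterministic ⇒any-[] ⇒any-[] = refl
  ⇒-deterministic ⇒term ⇒term = refl
  ⇒-deterministic ⇒term (⇒term-≠ x≢x) = ⊥-elim (x≢x refl)
  ⇒-deterministic ⇒term-[] ⇒term-[] = refl
  ⇒-deterministic (⇒term-≠ x≢x) ⇒term = ⊥-elim (x≢x refl)
  ⇒-deterministic (⇒term-≠ _) (⇒term-≠ _) = refl
  ⇒-deterministic (⇒/-fail _ d) (⇒/-fail _ d') = ⇒-deterministic d d'
  ⇒-deterministic (⇒/-fail d _) (⇒/-ok d') with () ← ⇒-deterministic d d'
  ⇒-deterministic (⇒/-ok d) (⇒/-fail d' _) with () ← ⇒-deterministic d d'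
  ⇒-deterministic (⇒/-ok d) (⇒/-ok d') = ⇒-deterministic d d'
  ⇒-deterministic (⇒︔-fail₁ _) (⇒︔-fail₁ _) = refl
  ⇒-deterministic (⇒︔-fail₁ d) (⇒︔-fail₂ d' _) with () ← ⇒-deterministic d d'
  ⇒-deterministic (⇒︔-fail₁ d) (⇒︔-ok d' _) with () ← ⇒-deterministic d d'
  ⇒-deterministic (⇒︔-fail₂ d _) (⇒︔-fail₁ d') with () ← ⇒-deterministic d d'
  ⇒-deterministic (⇒︔-fail₂ _ _) (⇒︔-fail₂ _ _) = refl
  ⇒-deterministic (⇒︔-fail₂ d₁ d₂) (⇒︔-ok d₁' d₂')
    with ⇒-deterministic d₁ d₁'
  ... | refl with () ← ⇒-deterministic d₂ d₂'
  ⇒-deterministic (⇒︔-ok d _) (⇒︔-fail₁ d') with () ← ⇒-deterministic d d'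
  ⇒-deterministic (⇒︔-ok d₁ d₂) (⇒︔-fail₂ d₁' d₂')
    with ⇒-deterministic d₁ d₁'
  ... | refl with () ← ⇒-deterministic d₂ d₂'
  ⇒-deterministic (⇒︔-ok d₁ d₂) (⇒︔-ok d₁' d₂')
    with ⇒-deterministic d₁ d₁'
  ... | refl with refl ← ⇒-deterministic d₂ d₂' = refl
  ⇒-deterministic (⇒*-fail _) (⇒*-fail _) = refl
  ⇒-deterministic (⇒*-fail d) (⇒*-ok d' _) with () ← ⇒-deterministic d d'
  ⇒-deterministic (⇒*-ok d _) (⇒*-fail d') with () ← ⇒-deterministic d d'
  ⇒-deterministic (⇒*-ok d₁ d₂) (⇒*-ok d₁' d₂')
    with ⇒-deterministic d₁ d₁'
  ... | refl with refl ← ⇒-deterministic d₂ d₂' = refl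
  ⇒-deterministic (⇒!-fail _) (⇒!-fail _) = refl
  ⇒-deterministic (⇒!-fail d) (⇒!-ok d') with () ← ⇒-deterministic d d'
  ⇒-deterministic (⇒!-ok d) (⇒!-fail d') with () ← ⇒-deterministic d d'
  ⇒-deterministic (⇒!-ok _) (⇒!-ok _) = refl
  ⇒-deterministic (⇒→-ok d) (⇒→-ok d') with refl ← ⇒-deterministic d d' = refl
  ⇒-deterministic (⇒→-ok d) (⇒→-fail d') with () ← ⇒-deterministic d d'
  ⇒-deterministic (⇒→-fail d) (⇒→-ok d') with () ← ⇒-deterministic d d'
  ⇒-deterministic (⇒→-fail _) (⇒→-fail _) = refl

  -- By determinism a derivation of e * on s must continue with a strictly
  -- smaller derivation of e * on the same s, so none exists.
  nonconsuming⇒¬*-derivation : ∀ {α} {e : Exp α} {s m v n r} →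
                               e , s ⇒[ m ] ok v s → ¬ ((e *) , s ⇒[ n ] r)
  nonconsuming⇒¬*-derivation d (⇒*-fail d') with () ← ⇒-deterministic d d'
  nonconsuming⇒¬*-derivation d (⇒*-ok d' rest) with refl ← ⇒-deterministic d d' =
    nonconsuming⇒¬*-derivation d rest

lemma3p6 : (G : XPEG) →
    ∀ {α : Set} (e : Semantics.Exp G α) (s : List (XPEG.VT G)) (m : ℕ) (v : α) →
    Semantics._,_⇒[_]_ G e s m (ok v s) →
    ¬ (∃[ n ] ∃[ r ] (Semantics._,_⇒[_]_ G (e *) s n r))
lemma3p6 G e s m v d (n , r , d*) = nonconsuming⇒¬*-derivation G d d*
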